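{- Let $G=(V,E)$ be a finite simple graph and let $S\subseteq V$ be a local maximum stable set of $G$. Let $H=G[N[S]]$ be the subgraph of $G$ induced by $N[S]=S\cup N(S)$, and suppose $H$ is a K\"{o}nig-Egerv\'{a}ry graph. If $M$ is a maximum matching in $H$, then $M$ (viewed as a set of vertices of the line graph $L(G)$) is a local maximum stable set in $L(G)$.
   Context: All graphs are finite, simple (undirected, no loops, no multiple edges). For $A\subseteq V$, $N(A)=\{v\in V-A : N(v)\cap A\neq\emptyset\}$ and $N[A]=A\cup N(A)$. A stable set is a set of pairwise non-adjacent vertices; $\alpha(G)$ is the maximum cardinality of a stable set. A set $A\subseteq V(G)$ is a local maximum stable set of $G$ if $A$ is a maximum stable set of the induced subgraph $G[N[A]]$. $\mu(G)$ denotes the size of a maximum matching of $G$. $G$ is a K\"{o}nig-Egerv\'{a}ry graph if $\alpha(G)+\mu(G)=|V(G)|$. The line graph $L(G)$ has vertex set $E(G)$, two edges being adjacent in $L(G)$ iff they share an endpoint in $G$. -}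

module Defs where

open import Data.Nat using (ℕ; _≤_; _+_)
open import Data.Fin using (Fin; _<?_)
open import Data.Fin.Properties using (any?; _≟_)
open import Data.Fin.Subset using (Subset; _∈_; _⊆_; ∣_∣)
open import Data.Fin.Subset.Properties using (_∈?_)
open import Data.Bool using (_∨_)
open import Data.Vec using (tabulate)
open import Data.List using (List; filter; cartesianProduct; length; lookup; allFin)
open import Data.Product using (Σ; ∃; _×_; _,_; proj₁; proj₂)
open import Relation.Nullary using (¬_; Dec; does)
open import Relation.Nullary.Decidable using (_×-dec_; _⊎-dec_; ¬?)
open import Relation.Binary.PropositionalEquality using (_≡_; _≢_; sym)
open import Data.Sum using (_⊎_; inj₁; inj₂)

record Graph : Set₁ where
  field
    n      : ℕ
    Adj    : Fin n → Fin n → Set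
    adj?   : ∀ u v → Dec (Adj u v)
    adj-sym : ∀ {u v} → Adj u v → Adj v u
    adj-irrefl : ∀ {v} → ¬ Adj v v
open Graph public

module _ (G : Graph) where
  private
    V = Fin (n G)

  Stable : Subset (n G) → Set
  Stable A = ∀ {u v} → u ∈ A → v ∈ A → ¬ Adj G u v

  closedNbhd : Subset (n G) → Subset (n G)
  closedNbhd A = tabulate λ v →
    does (v ∈? A) ∨ does (any? λ u → (u ∈? A) ×-dec adj? G u v)

  -- A is a maximum stable set of the induced subgraph G[W]
  -- (stable sets of G[W] are exactly the stable sets of G contained in W)
  IsMaxStableIn : Subset (n G) → Subset (n G) → Set
  IsMaxStableIn W A =
    A ⊆ W × Stable A × (∀ B → B ⊆ W → Stable B → ∣ B ∣ ≤ ∣ A ∣)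

  LocalMaxStable : Subset (n G) → Set
  LocalMaxStable A = IsMaxStableIn (closedNbhd A) A

  -- Edge list of G: each edge {u,v} listed once as (u , v) with u < v
  edgeList : List (V × V)
  edgeList = filter (λ p → (proj₁ p <? proj₂ p) ×-dec adj? G (proj₁ p) (proj₂ p))
                    (cartesianProduct (allFin (n G)) (allFin (n G)))

  numEdges : ℕ
  numEdges = length edgeList

  edge : Fin numEdges → V × V
  edge = lookup edgeList

  Share : V × V → V × V → Set
  Share (a , b) (c , d) = (a ≡ c ⊎ a ≡ d) ⊎ (b ≡ c ⊎ b ≡ d)

  share? : ∀ e f → Dec (Share e f)
  share? (a , b) (c , d) = ((a ≟ c) ⊎-dec (a ≟ d)) ⊎-dec ((b ≟ c) ⊎-dec (b ≟ d))

  share-sym : ∀ {e f} → Share e f → Share f e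
  share-sym (inj₁ (inj₁ p)) = inj₁ (inj₁ (sym p))
  share-sym (inj₁ (inj₂ p)) = inj₂ (inj₁ (sym p))
  share-sym (inj₂ (inj₁ p)) = inj₁ (inj₂ (sym p))
  share-sym (inj₂ (inj₂ p)) = inj₂ (inj₂ (sym p))

  IsMatchingIn : Subset (n G) → Subset numEdges → Set
  IsMatchingIn W M =
    (∀ {k} → k ∈ M → proj₁ (edge k) ∈ W × proj₂ (edge k) ∈ W) ×
    (∀ {k l} → k ∈ M → l ∈ M → k ≢ l → ¬ Share (edge k) (edge l))

  IsMaxMatchingIn : Subset (n G) → Subset numEdges → Set
  IsMaxMatchingIn W M =
    IsMatchingIn W M × (∀ M′ → IsMatchingIn W M′ → ∣ M′ ∣ ≤ ∣ M ∣)

  IsKEIn : Subset (n G) → Set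
  IsKEIn W = ∃ λ A → ∃ λ M →
    IsMaxStableIn W A × IsMaxMatchingIn W M × ∣ A ∣ + ∣ M ∣ ≡ ∣ W ∣

LineGraph : Graph → Graph
LineGraph G = record
  { n      = numEdges G
  ; Adj    = λ k l → k ≢ l × Share G (edge G k) (edge G l)
  ; adj?   = λ k l → ¬? (k ≟ l) ×-dec share? G (edge G k) (edge G l)
  ; adj-sym = λ { (ne , s) → (λ e → ne (sym e)) , share-sym G s }
  ; adj-irrefl = λ { (ne , _) → ne _≡_.refl }
  }

-- An edge set B that is stable in L(G) and lies in N[M] is a matching all of whose edges
-- touch N[S]. Each such edge has an endpoint in N(S) = N[S] − S (if it has an endpoint in S,
-- its other endpoint is in N(S) because S is stable), and distinct edges of a matching get
-- distinct endpoints, so |B| ≤ |N[S]| − |S|. As S is a maximum stable set of H and H is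
-- König–Egerváry, |N[S]| = α(H) + μ(H) = |S| + |M|, whence |B| ≤ |M|.
module Submission where

open import Defs
open import Data.Bool using (T; true; _∨_)
open import Data.Bool.Properties using (T-≡; T-∨; ∨-zeroʳ)
open import Data.Fin using (Fin; _<?_)
open import Data.Fin.Properties using (_≟_; any?; suc-injective; 0≢1+n)
open import Data.Fin.Subset using (Subset; inside; outside; _∈_; _⊆_; _─_; _-_; ∣_∣)
open import Data.Fin.Subset.Properties
  using (_∈?_; drop-∷-⊆; x∈p∧x∉q⇒x∈p─q; x∈p∧x≢y⇒x∈p-y; x∈p⇒∣p-x∣<∣p∣)
open import Data.List using (cartesianProduct; allFin)
open import Data.List.Membership.Propositional.Properties using (∈-lookup; ∈-filter⁻)
open import Data.Nat using (suc; _+_; _≤_; z≤n; s≤s)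
open import Data.Nat.Properties
  using (≤-trans; ≤-antisym; +-suc; +-comm; +-mono-≤; +-monoˡ-≤; +-cancelʳ-≤; module ≤-Reasoning)
open import Data.Product using (∃; _×_; _,_; proj₁; proj₂)
open import Data.Sum using (_⊎_; inj₁; inj₂)
import Data.Sum as Sum
open import Data.Vec using (_∷_; []; lookup; here; there)
open import Data.Vec.Properties using ([]=⇒lookup; lookup⇒[]=; lookup∘tabulate)
open import Function using (_∘_; Equivalence)
open import Relation.Nullary using (Dec; yes; no; does)
open import Relation.Nullary.Decidable using (dec-true; _×-dec_)
open import Relation.Nullary.Negation using (contradiction)
open import Relation.Binary.PropositionalEquality
  using (_≡_; refl; sym; trans; cong; subst; module ≡-Reasoning)

∣p─q∣+∣q∣≡∣p∣ : ∀ {m} {p q : Subset m} → q ⊆ p → ∣ p ─ q ∣ + ∣ q ∣ ≡ ∣ p ∣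
∣p─q∣+∣q∣≡∣p∣ {p = []}          {[]}          _   = refl
∣p─q∣+∣q∣≡∣p∣ {p = outside ∷ p} {outside ∷ q} q⊆p = ∣p─q∣+∣q∣≡∣p∣ (drop-∷-⊆ q⊆p)
∣p─q∣+∣q∣≡∣p∣ {p = inside  ∷ p} {outside ∷ q} q⊆p = cong suc (∣p─q∣+∣q∣≡∣p∣ (drop-∷-⊆ q⊆p))
∣p─q∣+∣q∣≡∣p∣ {p = inside  ∷ p} {inside  ∷ q} q⊆p =
  trans (+-suc (∣ p ─ q ∣) (∣ q ∣)) (cong suc (∣p─q∣+∣q∣≡∣p∣ (drop-∷-⊆ q⊆p)))
∣p─q∣+∣q∣≡∣p∣ {p = outside ∷ p} {inside  ∷ q} q⊆p = contradiction (q⊆p here) λ ()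

injection⇒∣≤∣ : ∀ {m k} (B : Subset m) (C : Subset k) (f : ∀ {i} → i ∈ B → Fin k) →
  (∀ {i} (i∈B : i ∈ B) → f i∈B ∈ C) →
  (∀ {i j} (i∈B : i ∈ B) (j∈B : j ∈ B) → f i∈B ≡ f j∈B → i ≡ j) →
  ∣ B ∣ ≤ ∣ C ∣
injection⇒∣≤∣ []            C f f∈C f-inj = z≤n
injection⇒∣≤∣ (outside ∷ B) C f f∈C f-inj =
  injection⇒∣≤∣ B C (λ i∈ → f (there i∈)) (λ i∈ → f∈C (there i∈))
    (λ i∈ j∈ → suc-injective ∘ f-inj (there i∈) (there j∈))
injection⇒∣≤∣ (inside ∷ B)  C f f∈C f-inj =
  ≤-trans (s≤s (injection⇒∣≤∣ B (C - f here) (λ i∈ → f (there i∈)) f∈C-f₀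
                 (λ i∈ j∈ → suc-injective ∘ f-inj (there i∈) (there j∈))))
          (x∈p⇒∣p-x∣<∣p∣ (f∈C here))
  where
  f∈C-f₀ : ∀ {i} (i∈B : i ∈ B) → f (there i∈B) ∈ C - f here
  f∈C-f₀ i∈ = x∈p∧x≢y⇒x∈p-y (f∈C (there i∈)) (λ eq → 0≢1+n (sym (f-inj (there i∈) here eq)))

module _ (G : Graph) where
  private
    adjacent? : ∀ A v → Dec (∃ λ u → u ∈ A × Adj G u v)
    adjacent? A v = any? λ u → (u ∈? A) ×-dec adj? G u v

  closedNbhd-lookup : ∀ A v → lookup (closedNbhd G A) v ≡ does (v ∈? A) ∨ does (adjacent? A v)
  closedNbhd-lookup A v = lookup∘tabulate _ v

  A⊆closedNbhd : ∀ {A} → A ⊆ closedNbhd G A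
  A⊆closedNbhd {A} {v} v∈A = lookup⇒[]= v _ (begin
    lookup (closedNbhd G A) v            ≡⟨ closedNbhd-lookup A v ⟩
    does (v ∈? A) ∨ does (adjacent? A v) ≡⟨ cong (_∨ does (adjacent? A v)) (dec-true (v ∈? A) v∈A) ⟩
    true                                 ∎)
    where open ≡-Reasoning

  adj⇒∈closedNbhd : ∀ {A u v} → u ∈ A → Adj G u v → v ∈ closedNbhd G A
  adj⇒∈closedNbhd {A} {u} {v} u∈A uv = lookup⇒[]= v _ (begin
    lookup (closedNbhd G A) v            ≡⟨ closedNbhd-lookup A v ⟩
    does (v ∈? A) ∨ does (adjacent? A v) ≡⟨ cong (does (v ∈? A) ∨_) (dec-true (adjacent? A v) (u , u∈A , uv)) ⟩
    does (v ∈? A) ∨ true                 ≡⟨ ∨-zeroʳ (does (v ∈? A)) ⟩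
    true                                 ∎)
    where open ≡-Reasoning

  ∈closedNbhd⁻ : ∀ {A v} → v ∈ closedNbhd G A → v ∈ A ⊎ ∃ λ u → u ∈ A × Adj G u v
  ∈closedNbhd⁻ {A} {v} v∈N =
    Sum.map (witness (v ∈? A)) (witness (adjacent? A v))
      (Equivalence.to T-∨ (Equivalence.from T-≡
        (trans (sym (closedNbhd-lookup A v)) ([]=⇒lookup v∈N))))
    where
    witness : ∀ {P : Set} (P? : Dec P) → T (does P?) → P
    witness (yes p) _  = p
    witness (no _)  ()

module _ (G : Graph) where
  private
    V = Fin (n G)

  Endpoint : V → V × V → Set
  Endpoint x e = x ≡ proj₁ e ⊎ x ≡ proj₂ e

  Touches : Subset (n G) → V × V → Set
  Touches W e = ∃ λ x → Endpoint x e × x ∈ W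

  share⇒common-endpoint : ∀ e f → Share G e f → ∃ λ x → Endpoint x e × Endpoint x f
  share⇒common-endpoint (a , b) (c , d) (inj₁ (inj₁ a≡c)) = a , inj₁ refl , inj₁ a≡c
  share⇒common-endpoint (a , b) (c , d) (inj₁ (inj₂ a≡d)) = a , inj₁ refl , inj₂ a≡d
  share⇒common-endpoint (a , b) (c , d) (inj₂ (inj₁ b≡c)) = b , inj₂ refl , inj₁ b≡c
  share⇒common-endpoint (a , b) (c , d) (inj₂ (inj₂ b≡d)) = b , inj₂ refl , inj₂ b≡d

  common-endpoint⇒share : ∀ {x} e f → Endpoint x e → Endpoint x f → Share G e f
  common-endpoint⇒share e f (inj₁ refl) (inj₁ refl) = inj₁ (inj₁ refl)
  common-endpoint⇒share e f (inj₁ refl) (inj₂ refl) = inj₁ (inj₂ refl)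
  common-endpoint⇒share e f (inj₂ refl) (inj₁ refl) = inj₂ (inj₁ refl)
  common-endpoint⇒share e f (inj₂ refl) (inj₂ refl) = inj₂ (inj₂ refl)

  edge-adjacent : ∀ k → Adj G (proj₁ (edge G k)) (proj₂ (edge G k))
  edge-adjacent k =
    proj₂ (proj₂ (∈-filter⁻ (λ e → (proj₁ e <? proj₂ e) ×-dec adj? G (proj₁ e) (proj₂ e))
                     {xs = cartesianProduct (allFin (n G)) (allFin (n G))} (∈-lookup k)))

  closedNbhd-touches : ∀ {W M} → (∀ {l} → l ∈ M → proj₁ (edge G l) ∈ W × proj₂ (edge G l) ∈ W) →
    ∀ {k} → k ∈ closedNbhd (LineGraph G) M → Touches W (edge G k)
  closedNbhd-touches ends∈W {k} k∈N with ∈closedNbhd⁻ (LineGraph G) k∈N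
  ... | inj₁ k∈M = proj₁ (edge G k) , inj₁ refl , proj₁ (ends∈W k∈M)
  ... | inj₂ (l , l∈M , _ , lk) with share⇒common-endpoint (edge G l) (edge G k) lk
  ...   | x , inj₁ refl , x∈k = x , x∈k , proj₁ (ends∈W l∈M)
  ...   | x , inj₂ refl , x∈k = x , x∈k , proj₂ (ends∈W l∈M)

  matching⇒stable-in-lineGraph : ∀ {W M} → IsMatchingIn G W M → Stable (LineGraph G) M
  matching⇒stable-in-lineGraph (_ , disjoint) k∈M l∈M (k≢l , kl) = disjoint k∈M l∈M k≢l kl

  stable-in-lineGraph-common-endpoint⇒≡ : ∀ {B} → Stable (LineGraph G) B → ∀ {k l x} → k ∈ B → l ∈ B →
    Endpoint x (edge G k) → Endpoint x (edge G l) → k ≡ l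
  stable-in-lineGraph-common-endpoint⇒≡ B-stable {k} {l} k∈B l∈B x∈k x∈l with k ≟ l
  ... | yes k≡l = k≡l
  ... | no  k≢l = contradiction (k≢l , common-endpoint⇒share (edge G k) (edge G l) x∈k x∈l)
                                (B-stable k∈B l∈B)

  module _ {S} (S-stable : Stable G S) where

    touches⇒endpoint∈closedNbhd─ : ∀ {e} → Adj G (proj₁ e) (proj₂ e) → Touches (closedNbhd G S) e →
      ∃ λ x → Endpoint x e × x ∈ closedNbhd G S ─ S
    touches⇒endpoint∈closedNbhd─ {u , v} uv touch with u ∈? S
    ... | yes u∈S =
      v , inj₂ refl , x∈p∧x∉q⇒x∈p─q (adj⇒∈closedNbhd G u∈S uv) (λ v∈S → S-stable u∈S v∈S uv)
    ... | no  u∉S with touch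
    ...   | y , inj₁ refl , u∈N = u , inj₁ refl , x∈p∧x∉q⇒x∈p─q u∈N u∉S
    ...   | y , inj₂ refl , v∈N with v ∈? S
    ...     | yes v∈S = u , inj₁ refl , x∈p∧x∉q⇒x∈p─q (adj⇒∈closedNbhd G v∈S (adj-sym G uv)) u∉S
    ...     | no  v∉S = v , inj₂ refl , x∈p∧x∉q⇒x∈p─q v∈N v∉S

    stable-in-lineGraph⇒∣≤∣closedNbhd─ : ∀ {M} →
      (∀ {l} → l ∈ M → proj₁ (edge G l) ∈ closedNbhd G S × proj₂ (edge G l) ∈ closedNbhd G S) →
      ∀ B → B ⊆ closedNbhd (LineGraph G) M → Stable (LineGraph G) B → ∣ B ∣ ≤ ∣ closedNbhd G S ─ S ∣
    stable-in-lineGraph⇒∣≤∣closedNbhd─ M-ends B B⊆N[M] B-stable =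
      injection⇒∣≤∣ B (closedNbhd G S ─ S) (proj₁ ∘ endpoint) (proj₂ ∘ proj₂ ∘ endpoint) endpoint-injective
      where
      endpoint : ∀ {k} → k ∈ B → ∃ λ x → Endpoint x (edge G k) × x ∈ closedNbhd G S ─ S
      endpoint {k} k∈B =
        touches⇒endpoint∈closedNbhd─ (edge-adjacent k) (closedNbhd-touches M-ends (B⊆N[M] k∈B))

      endpoint-injective : ∀ {k l} (k∈B : k ∈ B) (l∈B : l ∈ B) →
        proj₁ (endpoint k∈B) ≡ proj₁ (endpoint l∈B) → k ≡ l
      endpoint-injective {l = l} k∈B l∈B eq =
        stable-in-lineGraph-common-endpoint⇒≡ B-stable k∈B l∈B (proj₁ (proj₂ (endpoint k∈B)))
          (subst (λ x → Endpoint x (edge G l)) (sym eq) (proj₁ (proj₂ (endpoint l∈B))))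

KE⇒∣max-stable∣+∣max-matching∣≡∣W∣ : ∀ G {W S M} →
  IsKEIn G W → IsMaxStableIn G W S → IsMaxMatchingIn G W M → ∣ S ∣ + ∣ M ∣ ≡ ∣ W ∣
KE⇒∣max-stable∣+∣max-matching∣≡∣W∣ G {S = S} {M}
  (A , M₀ , (A⊆W , A-stable , A-max) , (M₀-matching , M₀-max) , ∣A∣+∣M₀∣≡∣W∣)
  (S⊆W , S-stable , S-max) (M-matching , M-max) =
  trans (≤-antisym (+-mono-≤ (A-max S S⊆W S-stable) (M₀-max M M-matching))
                   (+-mono-≤ (S-max A A⊆W A-stable) (M-max M₀ M₀-matching)))
        ∣A∣+∣M₀∣≡∣W∣

theorem2 : (G : Graph) (S : Subset (n G)) →
    LocalMaxStable G S →
    IsKEIn G (closedNbhd G S) →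
    (M : Subset (numEdges G)) →
    IsMaxMatchingIn G (closedNbhd G S) M →
    LocalMaxStable (LineGraph G) M
theorem2 G S S-lms@(S⊆N[S] , S-stable , _) H-KE M M-max@(M-matching@(M-ends , _) , _) =
  A⊆closedNbhd (LineGraph G) , matching⇒stable-in-lineGraph G M-matching , M-max-stable
  where
  M-max-stable : ∀ B → B ⊆ closedNbhd (LineGraph G) M → Stable (LineGraph G) B → ∣ B ∣ ≤ ∣ M ∣
  M-max-stable B B⊆N[M] B-stable = +-cancelʳ-≤ (∣ S ∣) (∣ B ∣) (∣ M ∣) (begin
    ∣ B ∣ + ∣ S ∣                    ≤⟨ +-monoˡ-≤ (∣ S ∣)
                                          (stable-in-lineGraph⇒∣≤∣closedNbhd─ G S-stable M-ends B B⊆N[M] B-stable) ⟩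
    ∣ closedNbhd G S ─ S ∣ + ∣ S ∣   ≡⟨ ∣p─q∣+∣q∣≡∣p∣ S⊆N[S] ⟩
    ∣ closedNbhd G S ∣               ≡⟨ KE⇒∣max-stable∣+∣max-matching∣≡∣W∣ G H-KE S-lms M-max ⟨
    ∣ S ∣ + ∣ M ∣                    ≡⟨ +-comm (∣ S ∣) (∣ M ∣) ⟩
    ∣ M ∣ + ∣ S ∣                    ∎)
    where open ≤-Reasoning
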